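{- Let $p$ be an odd prime and $\lambda\in\mathbb{C}_p$ with $|\lambda|_p<p^{ -\frac{1}{p-1}}$. For every positive integer $k$, $$\mathcal{E}_{k,\lambda}=-(1)_{k,\lambda}+\sum_{l=0}^{k-1}\binom{k}{l}(-1)^{k+l}(1)_{l,\lambda}\,\mathcal{E}_{k-l,-\lambda}.$$
   Context: $\mathbb{C}_p$ is the completion of the algebraic closure of $\mathbb{Q}_p$, with $|p|_p=1/p$. For $x,\mu\in\mathbb{C}_p$ define $(x)_{0,\mu}=1$ and $(x)_{n,\mu}=x(x-\mu)\cdots(x-(n-1)\mu)$ for $n\ge1$. For $\mu\in\mathbb{C}_p$ with $|\mu|_p<p^{ -\frac{1}{p-1}}$ (in particular $\mu=\pm\lambda$), the degenerate Euler numbers $\mathcal{E}_{n,\mu}$ are defined by $\frac{2}{(1+\mu t)^{1/\mu}+1}=\sum_{n\ge0}\mathcal{E}_{n,\mu}\frac{t^n}{n!}$. -}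

module Defs where

open import Level using (Level)
open import Data.Nat using (ℕ; zero; suc; _∸_; _≤ᵇ_)
open import Data.Nat.Combinatorics using (_C_)
open import Data.Bool using (if_then_else_)
open import Algebra.Bundles using (CommutativeRing)

-- All definitions are relative to a commutative ring R (standing in for ℂ_p).
module _ {c ℓ : Level} (R : CommutativeRing c ℓ) where
  open CommutativeRing R

  ℕ→R : ℕ → R .CommutativeRing.Carrier
  ℕ→R zero = 0#
  ℕ→R (suc n) = 1# + ℕ→R n

  negOnePow : ℕ → Carrier
  negOnePow zero = 1#
  negOnePow (suc n) = - negOnePow n

  fallFact : Carrier → Carrier → ℕ → Carrier
  fallFact x μ zero = 1#
  fallFact x μ (suc n) = fallFact x μ n * (x - ℕ→R n * μ)

  sumTo : ℕ → (ℕ → Carrier) → Carrier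
  sumTo zero f = 0#
  sumTo (suc n) f = sumTo n f + f n

  -- Degenerate Euler numbers 𝓔_{n,μ}, given an inverse `half` of 2 in R.
  -- Defined by comparing coefficients of t^n/n! in
  --   2 = (Σ 𝓔_{n,μ} t^n/n!) · ((1+μt)^{1/μ} + 1),
  -- where (1+μt)^{1/μ} = Σ (1)_{n,μ} t^n/n!.  This gives 𝓔_0 = 1 and, for n ≥ 1,
  --   0 = 2 𝓔_n + Σ_{l=1}^{n} C(n,l) (1)_{l,μ} 𝓔_{n-l}.
  private
    step : Carrier → Carrier → ℕ → (ℕ → Carrier) → Carrier
    step half μ n prev =
      - (half * sumTo n (λ j → ℕ→R (n C suc j) * fallFact 1# μ (suc j) * prev (n ∸ suc j)))

    -- eulerTab half μ n i = 𝓔_{i,μ} for all i ≤ n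
    eulerTab : Carrier → Carrier → ℕ → ℕ → Carrier
    eulerTab half μ zero i = 1#
    eulerTab half μ (suc n) i =
      if i ≤ᵇ n then eulerTab half μ n i else step half μ (suc n) (eulerTab half μ n)

  degEuler : Carrier → Carrier → ℕ → Carrier
  degEuler half μ n = eulerTab half μ n n

{-# OPTIONS --safe #-}
module Submission where

-- Read sequences as exponential generating functions, multiplied by binomial
-- convolution ⋆. The falling factorials e_μ(n) = (1)_{n,μ} are the coefficients of
-- (1 + μt)^{1/μ}, and 𝓔_{·,μ} is the unique solution X of X + e_μ ⋆ X = 2δ, 2 being
-- invertible. Vandermonde's identity makes ē(n) = (-1)_{n,λ} the ⋆-inverse of e_λ,
-- and e_{-λ}(n) = (-1)^n ē(n). As twisting by (-1)^n is multiplicative for ⋆, the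
-- sequence (-1)^n (e_λ ⋆ 𝓔_λ)(n) solves the equation for -λ, so that
-- 𝓔_{n,-λ} = (-1)^n (e_λ ⋆ 𝓔_λ)(n) = -(-1)^n 𝓔_{n,λ} for n ≥ 1. Substituting this
-- into the coefficient of t^k in 𝓔_λ + e_λ ⋆ 𝓔_λ = 2δ gives the identity.

open import Defs
open import Algebra.Bundles using (CommutativeRing; RawRing)
open import Data.Bool.Base using (true; false; T; if_then_else_)
open import Data.Maybe.Base using (Maybe; just; nothing)
open import Data.Nat using (ℕ; zero; suc; _≤_; _<_; _∸_; _≤ᵇ_; s≤s)
import Data.Nat as ℕ
import Data.Nat.Properties as ℕₚ
open import Data.Nat.Combinatorics using (_C_; nCn≡1; k>n⇒nCk≡0; nCk+nC[k+1]≡[n+1]C[k+1])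
open import Data.Product.Base using (Σ-syntax; _×_; _,_)
open import Data.Sum.Base using (inj₁; inj₂)
open import Function.Base using (_∘_)
open import Level using (0ℓ)
open import Relation.Binary.PropositionalEquality as ≡ using (_≡_)
open import Relation.Nullary using (¬_; contradiction)
open import Relation.Nullary.Decidable using (yes; no)

if-T : ∀ {a} {A : Set a} b {x y : A} → T b → (if b then x else y) ≡ x
if-T true _ = ≡.refl

if-¬T : ∀ {a} {A : Set a} b {x y : A} → ¬ T b → (if b then x else y) ≡ y
if-¬T true ¬t = contradiction _ ¬t
if-¬T false _ = ≡.refl

module _ {c ℓ} (R : CommutativeRing c ℓ) where
  open CommutativeRing R
  open import Relation.Binary.Reasoning.Setoid setoid

  ℕ→R-homo-+ : ∀ m n → ℕ→R R (m ℕ.+ n) ≈ ℕ→R R m + ℕ→R R n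
  ℕ→R-homo-+ zero n = sym (+-identityˡ _)
  ℕ→R-homo-+ (suc m) n = trans (+-congˡ (ℕ→R-homo-+ m n)) (sym (+-assoc _ _ _))

  ℕ→R-homo-* : ∀ m n → ℕ→R R (m ℕ.* n) ≈ ℕ→R R m * ℕ→R R n
  ℕ→R-homo-* zero n = sym (zeroˡ _)
  ℕ→R-homo-* (suc m) n = begin
    ℕ→R R (n ℕ.+ m ℕ.* n)              ≈⟨ ℕ→R-homo-+ n (m ℕ.* n) ⟩
    ℕ→R R n + ℕ→R R (m ℕ.* n)          ≈⟨ +-cong (sym (*-identityˡ _)) (ℕ→R-homo-* m n) ⟩
    1# * ℕ→R R n + ℕ→R R m * ℕ→R R n   ≈⟨ distribʳ _ _ _ ⟨
    (1# + ℕ→R R m) * ℕ→R R n           ∎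

-- Algebra.Solver.Ring needs coefficients with decidable equality: we use the
-- integers, as pairs (a , b) standing for a - b, mapped into R through ℕ→R.
module RingSolver {c ℓ} (R : CommutativeRing c ℓ) where
  open CommutativeRing R
  open import Algebra.Properties.Ring ring using (-0#≈0#; -‿+-comm; ⁻¹-anti-homo‿-; [y-z]x≈yx-zx; x[y-z]≈xy-xz)
  open import Algebra.Properties.CommutativeSemigroup +-commutativeSemigroup using (interchange)
  open import Algebra.Solver.Ring.AlmostCommutativeRing using (fromCommutativeRing; _-Raw-AlmostCommutative⟶_)
  open import Relation.Binary.Reasoning.Setoid setoid

  ℤ-as-ℕ×ℕ : RawRing 0ℓ 0ℓ
  ℤ-as-ℕ×ℕ = record
    { Carrier = ℕ × ℕ
    ; _≈_ = _≡_
    ; _+_ = λ { (a , b) (c , d) → (a ℕ.+ c , b ℕ.+ d) }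
    ; _*_ = λ { (a , b) (c , d) → (a ℕ.* c ℕ.+ b ℕ.* d , a ℕ.* d ℕ.+ b ℕ.* c) }
    ; -_ = λ { (a , b) → (b , a) }
    ; 0# = (0 , 0)
    ; 1# = (1 , 0)
    }

  ⟦_⟧ : ℕ × ℕ → Carrier
  ⟦ a , b ⟧ = ℕ→R R a - ℕ→R R b

  [p-q]+[r-s]≈[p+r]-[q+s] : ∀ p q r s → (p - q) + (r - s) ≈ (p + r) - (q + s)
  [p-q]+[r-s]≈[p+r]-[q+s] p q r s = trans (interchange _ _ _ _) (+-congˡ (-‿+-comm q s))

  ⟦⟧-homo-+ : ∀ a b c d → ⟦ a ℕ.+ c , b ℕ.+ d ⟧ ≈ ⟦ a , b ⟧ + ⟦ c , d ⟧
  ⟦⟧-homo-+ a b c d = begin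
    ℕ→R R (a ℕ.+ c) - ℕ→R R (b ℕ.+ d)
      ≈⟨ +-cong (ℕ→R-homo-+ R a c) (-‿cong (ℕ→R-homo-+ R b d)) ⟩
    (ℕ→R R a + ℕ→R R c) - (ℕ→R R b + ℕ→R R d)
      ≈⟨ [p-q]+[r-s]≈[p+r]-[q+s] _ _ _ _ ⟨
    ⟦ a , b ⟧ + ⟦ c , d ⟧ ∎

  ⟦⟧-homo-* : ∀ a b c d → ⟦ a ℕ.* c ℕ.+ b ℕ.* d , a ℕ.* d ℕ.+ b ℕ.* c ⟧ ≈ ⟦ a , b ⟧ * ⟦ c , d ⟧
  ⟦⟧-homo-* a b c d = begin
    ℕ→R R (a ℕ.* c ℕ.+ b ℕ.* d) - ℕ→R R (a ℕ.* d ℕ.+ b ℕ.* c)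
      ≈⟨ +-cong (sum-of-products a c b d) (-‿cong (sum-of-products a d b c)) ⟩
    (a′ * c′ + b′ * d′) - (a′ * d′ + b′ * c′)
      ≈⟨ [p-q]+[r-s]≈[p+r]-[q+s] _ _ _ _ ⟨
    (a′ * c′ - a′ * d′) + (b′ * d′ - b′ * c′)
      ≈⟨ +-congˡ (⁻¹-anti-homo‿- _ _) ⟨
    (a′ * c′ - a′ * d′) - (b′ * c′ - b′ * d′)
      ≈⟨ +-cong (x[y-z]≈xy-xz a′ c′ d′) (-‿cong (x[y-z]≈xy-xz b′ c′ d′)) ⟨
    a′ * (c′ - d′) - b′ * (c′ - d′)
      ≈⟨ [y-z]x≈yx-zx (c′ - d′) a′ b′ ⟨
    (a′ - b′) * (c′ - d′)
      ∎
    where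
    a′ b′ c′ d′ : Carrier
    a′ = ℕ→R R a
    b′ = ℕ→R R b
    c′ = ℕ→R R c
    d′ = ℕ→R R d
    sum-of-products : ∀ m n p q → ℕ→R R (m ℕ.* n ℕ.+ p ℕ.* q) ≈ ℕ→R R m * ℕ→R R n + ℕ→R R p * ℕ→R R q
    sum-of-products m n p q =
      trans (ℕ→R-homo-+ R (m ℕ.* n) (p ℕ.* q)) (+-cong (ℕ→R-homo-* R m n) (ℕ→R-homo-* R p q))

  ⟦d,d⟧≈0 : ∀ d → ⟦ d , d ⟧ ≈ 0#
  ⟦d,d⟧≈0 d = -‿inverseʳ _

  homomorphism : ℤ-as-ℕ×ℕ -Raw-AlmostCommutative⟶ fromCommutativeRing R
  homomorphism = record
    { ⟦_⟧ = ⟦_⟧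
    ; +-homo = λ { (a , b) (c , d) → ⟦⟧-homo-+ a b c d }
    ; *-homo = λ { (a , b) (c , d) → ⟦⟧-homo-* a b c d }
    ; -‿homo = λ { (a , b) → sym (⁻¹-anti-homo‿- _ _) }
    ; 0-homo = ⟦d,d⟧≈0 0
    ; 1-homo = trans (+-congˡ -0#≈0#) (trans (+-identityʳ _) (+-identityʳ _))
    }

  ⟦⟧-≟ : ∀ p q → Maybe (⟦ p ⟧ ≈ ⟦ q ⟧)
  ⟦⟧-≟ (a , b) (c , d) with a ℕ.+ d ℕₚ.≟ b ℕ.+ c
  ... | no _ = nothing
  ... | yes a+d≡b+c = just (begin
    ⟦ a , b ⟧                  ≈⟨ +-identityʳ _ ⟨
    ⟦ a , b ⟧ + 0#             ≈⟨ +-congˡ (⟦d,d⟧≈0 d) ⟨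
    ⟦ a , b ⟧ + ⟦ d , d ⟧      ≈⟨ ⟦⟧-homo-+ a b d d ⟨
    ⟦ a ℕ.+ d , b ℕ.+ d ⟧      ≡⟨ ≡.cong (λ x → ⟦ x , b ℕ.+ d ⟧) a+d≡b+c ⟩
    ⟦ b ℕ.+ c , b ℕ.+ d ⟧      ≈⟨ ⟦⟧-homo-+ b b c d ⟩
    ⟦ b , b ⟧ + ⟦ c , d ⟧      ≈⟨ +-congʳ (⟦d,d⟧≈0 b) ⟩
    0# + ⟦ c , d ⟧             ≈⟨ +-identityˡ _ ⟩
    ⟦ c , d ⟧                  ∎)

  open import Algebra.Solver.Ring ℤ-as-ℕ×ℕ (fromCommutativeRing R) homomorphism ⟦⟧-≟ public
    using (solve; _:=_; _:+_; _:*_; :-_; _:-_)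

module DegenerateEulerNumbers {c ℓ} (R : CommutativeRing c ℓ) where
  open CommutativeRing R
  open import Algebra.Properties.Ring ring
    using (-‿distribˡ-*; -‿distribʳ-*; -1*x≈-x; -0#≈0#; -‿+-comm; +-cancelʳ; +-inverseʳ-unique)
  open import Algebra.Properties.CommutativeSemigroup +-commutativeSemigroup using (interchange)
  open import Relation.Binary.Reasoning.Setoid setoid
  open RingSolver R

  sumTo-cong : ∀ n {f g : ℕ → Carrier} → (∀ j → j < n → f j ≈ g j) → sumTo R n f ≈ sumTo R n g
  sumTo-cong zero f≈g = refl
  sumTo-cong (suc n) f≈g = +-cong (sumTo-cong n (λ j j<n → f≈g j (ℕₚ.m<n⇒m<1+n j<n))) (f≈g n ℕₚ.≤-refl)

  sumTo-+ : ∀ n (f g : ℕ → Carrier) → sumTo R n (λ j → f j + g j) ≈ sumTo R n f + sumTo R n g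
  sumTo-+ zero f g = sym (+-identityˡ _)
  sumTo-+ (suc n) f g = trans (+-congʳ (sumTo-+ n f g)) (interchange _ _ _ _)

  sumTo-sucˡ : ∀ n (f : ℕ → Carrier) → sumTo R (suc n) f ≈ f 0 + sumTo R n (λ j → f (suc j))
  sumTo-sucˡ zero f = trans (+-identityˡ _) (sym (+-identityʳ _))
  sumTo-sucˡ (suc n) f = trans (+-congʳ (sumTo-sucˡ n f)) (+-assoc _ _ _)

  sumTo-neg : ∀ n (f : ℕ → Carrier) → sumTo R n (λ j → - f j) ≈ - sumTo R n f
  sumTo-neg zero f = sym -0#≈0#
  sumTo-neg (suc n) f = trans (+-congʳ (sumTo-neg n f)) (-‿+-comm _ _)

  -- Binomial convolution

  Seq : Set c
  Seq = ℕ → Carrier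

  infix 4 _≋_
  _≋_ : Seq → Seq → Set ℓ
  a ≋ b = ∀ n → a n ≈ b n

  infixl 6 _⊕_
  _⊕_ : Seq → Seq → Seq
  (a ⊕ b) n = a n + b n

  infixr 7 _·_
  _·_ : Carrier → Seq → Seq
  (x · a) n = x * a n

  shift : Seq → Seq
  shift a n = a (suc n)

  δ : Seq
  δ zero = 1#
  δ (suc n) = 0#

  -- The product of exponential generating functions, defined through the Leibniz rule
  -- (a b)′ = a′ b + a b′ instead of the binomial sum (⋆-binomial) so that its laws
  -- follow by plain induction.
  infixl 7 _⋆_
  _⋆_ : Seq → Seq → Seq
  (a ⋆ b) zero = a 0 * b 0
  (a ⋆ b) (suc n) = (shift a ⋆ b) n + (a ⋆ shift b) n

  ⋆-cong : ∀ {a a′ b b′} → a ≋ a′ → b ≋ b′ → a ⋆ b ≋ a′ ⋆ b′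
  ⋆-cong a≋a′ b≋b′ zero = *-cong (a≋a′ 0) (b≋b′ 0)
  ⋆-cong a≋a′ b≋b′ (suc n) =
    +-cong (⋆-cong (λ i → a≋a′ (suc i)) b≋b′ n) (⋆-cong a≋a′ (λ i → b≋b′ (suc i)) n)

  ⋆-comm : ∀ a b → a ⋆ b ≋ b ⋆ a
  ⋆-comm a b zero = *-comm _ _
  ⋆-comm a b (suc n) = trans (+-cong (⋆-comm (shift a) b n) (⋆-comm a (shift b) n)) (+-comm _ _)

  ⋆-distribʳ : ∀ a b c → (a ⊕ b) ⋆ c ≋ a ⋆ c ⊕ b ⋆ c
  ⋆-distribʳ a b c zero = distribʳ _ _ _
  ⋆-distribʳ a b c (suc n) =
    trans (+-cong (⋆-distribʳ (shift a) (shift b) c n) (⋆-distribʳ a b (shift c) n)) (interchange _ _ _ _)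

  ⋆-distribˡ : ∀ a b c → a ⋆ (b ⊕ c) ≋ a ⋆ b ⊕ a ⋆ c
  ⋆-distribˡ a b c n = begin
    (a ⋆ (b ⊕ c)) n          ≈⟨ ⋆-comm a (b ⊕ c) n ⟩
    ((b ⊕ c) ⋆ a) n          ≈⟨ ⋆-distribʳ b c a n ⟩
    (b ⋆ a) n + (c ⋆ a) n    ≈⟨ +-cong (⋆-comm b a n) (⋆-comm c a n) ⟩
    (a ⋆ b) n + (a ⋆ c) n    ∎

  ⋆-·-assocˡ : ∀ x a b → (x · a) ⋆ b ≋ x · (a ⋆ b)
  ⋆-·-assocˡ x a b zero = *-assoc _ _ _
  ⋆-·-assocˡ x a b (suc n) =
    trans (+-cong (⋆-·-assocˡ x (shift a) b n) (⋆-·-assocˡ x a (shift b) n)) (sym (distribˡ _ _ _))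

  ⋆-·-assocʳ : ∀ x a b → a ⋆ (x · b) ≋ x · (a ⋆ b)
  ⋆-·-assocʳ x a b n = begin
    (a ⋆ (x · b)) n  ≈⟨ ⋆-comm a (x · b) n ⟩
    ((x · b) ⋆ a) n  ≈⟨ ⋆-·-assocˡ x b a n ⟩
    x * (b ⋆ a) n    ≈⟨ *-congˡ (⋆-comm b a n) ⟩
    x * (a ⋆ b) n    ∎

  ⋆-zeroˡ : ∀ b → (λ _ → 0#) ⋆ b ≋ λ _ → 0#
  ⋆-zeroˡ b zero = zeroˡ _
  ⋆-zeroˡ b (suc n) = trans (+-cong (⋆-zeroˡ b n) (⋆-zeroˡ (shift b) n)) (+-identityˡ _)

  ⋆-identityˡ : ∀ b → δ ⋆ b ≋ b
  ⋆-identityˡ b zero = *-identityˡ _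
  ⋆-identityˡ b (suc n) = trans (+-cong (⋆-zeroˡ b n) (⋆-identityˡ (shift b) n)) (+-identityˡ _)

  ⋆-assoc : ∀ a b c → (a ⋆ b) ⋆ c ≋ a ⋆ (b ⋆ c)
  ⋆-assoc a b c zero = *-assoc _ _ _
  ⋆-assoc a b c (suc n) = begin
    ((shift a ⋆ b ⊕ a ⋆ shift b) ⋆ c) n + ((a ⋆ b) ⋆ shift c) n
      ≈⟨ +-congʳ (⋆-distribʳ (shift a ⋆ b) (a ⋆ shift b) c n) ⟩
    (((shift a ⋆ b) ⋆ c) n + ((a ⋆ shift b) ⋆ c) n) + ((a ⋆ b) ⋆ shift c) n
      ≈⟨ +-cong (+-cong (⋆-assoc (shift a) b c n) (⋆-assoc a (shift b) c n)) (⋆-assoc a b (shift c) n) ⟩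
    ((shift a ⋆ (b ⋆ c)) n + (a ⋆ (shift b ⋆ c)) n) + (a ⋆ (b ⋆ shift c)) n
      ≈⟨ +-assoc _ _ _ ⟩
    (shift a ⋆ (b ⋆ c)) n + ((a ⋆ (shift b ⋆ c)) n + (a ⋆ (b ⋆ shift c)) n)
      ≈⟨ +-congˡ (⋆-distribˡ a (shift b ⋆ c) (b ⋆ shift c) n) ⟨
    (shift a ⋆ (b ⋆ c)) n + (a ⋆ (shift b ⋆ c ⊕ b ⋆ shift c)) n
      ∎

  ⋆-binomial : ∀ a b n → (a ⋆ b) n ≈ sumTo R (suc n) (λ l → ℕ→R R (n C l) * a l * b (n ∸ l))
  ⋆-binomial a b zero = sym (trans (+-identityˡ _) (*-congʳ (trans (*-congʳ (+-identityʳ 1#)) (*-identityˡ _))))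
  ⋆-binomial a b (suc n) = begin
    (shift a ⋆ b) n + (a ⋆ shift b) n
      ≈⟨ +-cong (⋆-binomial (shift a) b n) (⋆-binomial a (shift b) n) ⟩
    sumTo R (suc n) P + sumTo R (suc n) (λ l → ℕ→R R (n C l) * a l * b (suc (n ∸ l)))
      ≈⟨ +-congˡ (sumTo-sucˡ n _) ⟩
    sumTo R (suc n) P + (first + sumTo R n (λ l → ℕ→R R (n C suc l) * a (suc l) * b (suc (n ∸ suc l))))
      ≈⟨ +-congˡ (+-congˡ (sumTo-cong n (λ l l<n → *-congˡ (reflexive (≡.cong b (ℕₚ.+-∸-assoc 1 l<n)))))) ⟨
    sumTo R (suc n) P + (first + sumTo R n Q)
      ≈⟨ x+[y+z]≈y+[x+z] _ _ _ ⟩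
    first + (sumTo R (suc n) P + sumTo R n Q)
      ≈⟨ +-congˡ (+-congˡ (trans (+-congˡ Q[n]≈0) (+-identityʳ _))) ⟨
    first + (sumTo R (suc n) P + sumTo R (suc n) Q)
      ≈⟨ +-congˡ (sumTo-+ (suc n) P Q) ⟨
    first + sumTo R (suc n) (λ l → P l + Q l)
      ≈⟨ +-congˡ (sumTo-cong (suc n) (λ l _ → pascal l)) ⟩
    first + sumTo R (suc n) (λ l → ℕ→R R (suc n C suc l) * a (suc l) * b (n ∸ l))
      ≈⟨ sumTo-sucˡ (suc n) _ ⟨
    sumTo R (suc (suc n)) (λ l → ℕ→R R (suc n C l) * a l * b (suc n ∸ l))
      ∎
    where
    P Q : Seq
    P l = ℕ→R R (n C l) * a (suc l) * b (n ∸ l)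
    Q l = ℕ→R R (n C suc l) * a (suc l) * b (n ∸ l)
    first : Carrier
    first = ℕ→R R 1 * a 0 * b (suc n)
    x+[y+z]≈y+[x+z] : ∀ x y z → x + (y + z) ≈ y + (x + z)
    x+[y+z]≈y+[x+z] = solve 3 (λ x y z → x :+ (y :+ z) := y :+ (x :+ z)) refl
    Q[n]≈0 : Q n ≈ 0#
    Q[n]≈0 = begin
      ℕ→R R (n C suc n) * a (suc n) * b (n ∸ n)
        ≡⟨ ≡.cong (λ k → ℕ→R R k * a (suc n) * b (n ∸ n)) (k>n⇒nCk≡0 (ℕₚ.n<1+n n)) ⟩
      0# * a (suc n) * b (n ∸ n)
        ≈⟨ trans (*-congʳ (zeroˡ _)) (zeroˡ _) ⟩
      0#
        ∎
    pascal : ∀ l → P l + Q l ≈ ℕ→R R (suc n C suc l) * a (suc l) * b (n ∸ l)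
    pascal l = begin
      P l + Q l
        ≈⟨ distribʳ _ _ _ ⟨
      (ℕ→R R (n C l) * a (suc l) + ℕ→R R (n C suc l) * a (suc l)) * b (n ∸ l)
        ≈⟨ *-congʳ (distribʳ _ _ _) ⟨
      (ℕ→R R (n C l) + ℕ→R R (n C suc l)) * a (suc l) * b (n ∸ l)
        ≈⟨ *-congʳ (*-congʳ (ℕ→R-homo-+ R (n C l) (n C suc l))) ⟨
      ℕ→R R (n C l ℕ.+ n C suc l) * a (suc l) * b (n ∸ l)
        ≡⟨ ≡.cong (λ k → ℕ→R R k * a (suc l) * b (n ∸ l)) (nCk+nC[k+1]≡[n+1]C[k+1] n l) ⟩
      ℕ→R R (suc n C suc l) * a (suc l) * b (n ∸ l)
        ∎

  ⋆-binomial-last : ∀ a b n → (a ⋆ b) n ≈ sumTo R n (λ l → ℕ→R R (n C l) * a l * b (n ∸ l)) + a n * b 0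
  ⋆-binomial-last a b n = trans (⋆-binomial a b n) (+-congˡ (begin
    ℕ→R R (n C n) * a n * b (n ∸ n)  ≡⟨ ≡.cong₂ (λ i j → ℕ→R R i * a n * b j) (nCn≡1 n) (ℕₚ.n∸n≡0 n) ⟩
    (1# + 0#) * a n * b 0            ≈⟨ *-congʳ (trans (*-congʳ (+-identityʳ 1#)) (*-identityˡ _)) ⟩
    a n * b 0                        ∎))

  binomialTail : Seq → Seq → ℕ → Carrier
  binomialTail a b n = sumTo R (suc n) (λ j → ℕ→R R (suc n C suc j) * a (suc j) * b (n ∸ j))

  ⋆-suc : ∀ a b n → (a ⋆ b) (suc n) ≈ a 0 * b (suc n) + binomialTail a b n
  ⋆-suc a b n = begin
    (a ⋆ b) (suc n)                                     ≈⟨ ⋆-binomial a b (suc n) ⟩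
    sumTo R (suc (suc n)) (λ l → ℕ→R R (suc n C l) * a l * b (suc n ∸ l))
                                                        ≈⟨ sumTo-sucˡ (suc n) _ ⟩
    ℕ→R R 1 * a 0 * b (suc n) + binomialTail a b n     ≈⟨ +-congʳ (*-congʳ (trans (*-congʳ (+-identityʳ 1#)) (*-identityˡ _))) ⟩
    a 0 * b (suc n) + binomialTail a b n               ∎

  binomialTail-cong : ∀ a n {b b′} → (∀ i → i ≤ n → b i ≈ b′ i) → binomialTail a b n ≈ binomialTail a b′ n
  binomialTail-cong a n b≈b′ = sumTo-cong (suc n) (λ j _ → *-congˡ (b≈b′ (n ∸ j) (ℕₚ.m∸n≤m n j)))

  -- Falling factorials and the sign twist

  fallFact-cong : ∀ {x y} μ → x ≈ y → fallFact R x μ ≋ fallFact R y μ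
  fallFact-cong μ x≈y zero = refl
  fallFact-cong μ x≈y (suc n) = *-cong (fallFact-cong μ x≈y n) (+-congʳ x≈y)

  fallFact-suc : ∀ x μ n → fallFact R x μ (suc n) ≈ x * fallFact R (x - μ) μ n
  fallFact-suc x μ zero = begin
    1# * (x - 0# * μ)  ≈⟨ *-identityˡ _ ⟩
    x - 0# * μ         ≈⟨ +-congˡ (trans (-‿cong (zeroˡ μ)) -0#≈0#) ⟩
    x + 0#             ≈⟨ +-identityʳ x ⟩
    x                  ≈⟨ *-identityʳ x ⟨
    x * 1#             ∎
  fallFact-suc x μ (suc n) = begin
    fallFact R x μ (suc n) * (x - (1# + ℕ→R R n) * μ)
      ≈⟨ *-cong (fallFact-suc x μ n) (+-congˡ (-‿cong (trans (distribʳ _ _ _) (+-congʳ (*-identityˡ μ))))) ⟩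
    x * fallFact R (x - μ) μ n * (x - (μ + ℕ→R R n * μ))
      ≈⟨ shuffle x (fallFact R (x - μ) μ n) μ (ℕ→R R n * μ) ⟩
    x * (fallFact R (x - μ) μ n * ((x - μ) - ℕ→R R n * μ))
      ∎
    where
    shuffle : ∀ x f u v → x * f * (x - (u + v)) ≈ x * (f * ((x - u) - v))
    shuffle = solve 4 (λ x f u v → x :* f :* (x :- (u :+ v)) := x :* (f :* ((x :- u) :- v))) refl

  fallFact-vandermonde : ∀ μ x y → fallFact R x μ ⋆ fallFact R y μ ≋ fallFact R (x + y) μ
  fallFact-vandermonde μ x y zero = *-identityˡ _
  fallFact-vandermonde μ x y (suc n) = begin
    (shift (fallFact R x μ) ⋆ fallFact R y μ) n + (fallFact R x μ ⋆ shift (fallFact R y μ)) n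
      ≈⟨ +-cong (⋆-cong (fallFact-suc x μ) (λ _ → refl) n) (⋆-cong (λ _ → refl) (fallFact-suc y μ) n) ⟩
    ((x · fallFact R (x - μ) μ) ⋆ fallFact R y μ) n + (fallFact R x μ ⋆ (y · fallFact R (y - μ) μ)) n
      ≈⟨ +-cong (⋆-·-assocˡ x _ _ n) (⋆-·-assocʳ y _ _ n) ⟩
    x * (fallFact R (x - μ) μ ⋆ fallFact R y μ) n + y * (fallFact R x μ ⋆ fallFact R (y - μ) μ) n
      ≈⟨ +-cong (*-congˡ (fallFact-vandermonde μ (x - μ) y n)) (*-congˡ (fallFact-vandermonde μ x (y - μ) n)) ⟩
    x * fallFact R ((x - μ) + y) μ n + y * fallFact R (x + (y - μ)) μ n
      ≈⟨ +-cong (*-congˡ (fallFact-cong μ ([x-u]+y≈[x+y]-u x y μ) n))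
                (*-congˡ (fallFact-cong μ (sym (+-assoc x y (- μ))) n)) ⟩
    x * fallFact R ((x + y) - μ) μ n + y * fallFact R ((x + y) - μ) μ n
      ≈⟨ distribʳ _ _ _ ⟨
    (x + y) * fallFact R ((x + y) - μ) μ n
      ≈⟨ fallFact-suc (x + y) μ n ⟨
    fallFact R (x + y) μ (suc n)
      ∎
    where
    [x-u]+y≈[x+y]-u : ∀ x y u → (x - u) + y ≈ (x + y) - u
    [x-u]+y≈[x+y]-u = solve 3 (λ x y u → (x :- u) :+ y := (x :+ y) :- u) refl

  fallFact-0# : ∀ μ → fallFact R 0# μ ≋ δ
  fallFact-0# μ zero = refl
  fallFact-0# μ (suc n) = trans (fallFact-suc 0# μ n) (zeroˡ _)

  fallFact-⋆-inverse : ∀ μ x → fallFact R (- x) μ ⋆ fallFact R x μ ≋ δ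
  fallFact-⋆-inverse μ x n = begin
    (fallFact R (- x) μ ⋆ fallFact R x μ) n  ≈⟨ fallFact-vandermonde μ (- x) x n ⟩
    fallFact R (- x + x) μ n                 ≈⟨ fallFact-cong μ (-‿inverseˡ x) n ⟩
    fallFact R 0# μ n                        ≈⟨ fallFact-0# μ n ⟩
    δ n                                      ∎

  negOnePow-+ : ∀ m n → negOnePow R (m ℕ.+ n) ≈ negOnePow R m * negOnePow R n
  negOnePow-+ zero n = sym (*-identityˡ _)
  negOnePow-+ (suc m) n = trans (-‿cong (negOnePow-+ m n)) (-‿distribˡ-* _ _)

  negOnePow-*-self : ∀ n → negOnePow R n * negOnePow R n ≈ 1#
  negOnePow-*-self zero = *-identityˡ _
  negOnePow-*-self (suc n) = trans (-x*-x≈x*x (negOnePow R n)) (negOnePow-*-self n)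
    where
    -x*-x≈x*x : ∀ x → - x * - x ≈ x * x
    -x*-x≈x*x = solve 1 (λ x → :- x :* :- x := x :* x) refl

  negOnePow-+-∸ : ∀ {k l} → l ≤ k → negOnePow R (k ℕ.+ l) * negOnePow R (k ∸ l) ≈ 1#
  negOnePow-+-∸ {k} {l} l≤k = begin
    negOnePow R (k ℕ.+ l) * negOnePow R (k ∸ l)              ≈⟨ *-congʳ (negOnePow-+ k l) ⟩
    negOnePow R k * negOnePow R l * negOnePow R (k ∸ l)      ≈⟨ *-assoc _ _ _ ⟩
    negOnePow R k * (negOnePow R l * negOnePow R (k ∸ l))    ≈⟨ *-congˡ (negOnePow-+ l (k ∸ l)) ⟨
    negOnePow R k * negOnePow R (l ℕ.+ (k ∸ l))              ≡⟨ ≡.cong (λ m → negOnePow R k * negOnePow R m) (ℕₚ.m+[n∸m]≡n l≤k) ⟩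
    negOnePow R k * negOnePow R k                            ≈⟨ negOnePow-*-self k ⟩
    1#                                                       ∎

  alternate : Seq → Seq
  alternate a n = negOnePow R n * a n

  alternate-⋆ : ∀ a b → alternate a ⋆ alternate b ≋ alternate (a ⋆ b)
  alternate-⋆ a b zero = trans (*-cong (*-identityˡ _) (*-identityˡ _)) (sym (*-identityˡ _))
  alternate-⋆ a b (suc n) = begin
    (shift (alternate a) ⋆ alternate b) n + (alternate a ⋆ shift (alternate b)) n
      ≈⟨ +-cong (⋆-cong (shift-alternate a) (λ _ → refl) n) (⋆-cong (λ _ → refl) (shift-alternate b) n) ⟩
    ((- 1# · alternate (shift a)) ⋆ alternate b) n + (alternate a ⋆ (- 1# · alternate (shift b))) n
      ≈⟨ +-cong (⋆-·-assocˡ _ _ _ n) (⋆-·-assocʳ _ _ _ n) ⟩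
    - 1# * (alternate (shift a) ⋆ alternate b) n + - 1# * (alternate a ⋆ alternate (shift b)) n
      ≈⟨ +-cong (*-congˡ (alternate-⋆ (shift a) b n)) (*-congˡ (alternate-⋆ a (shift b) n)) ⟩
    - 1# * (negOnePow R n * (shift a ⋆ b) n) + - 1# * (negOnePow R n * (a ⋆ shift b) n)
      ≈⟨ factor _ _ _ _ ⟩
    (- 1# * negOnePow R n) * ((shift a ⋆ b) n + (a ⋆ shift b) n)
      ≈⟨ *-congʳ (-1*x≈-x _) ⟩
    negOnePow R (suc n) * (a ⋆ b) (suc n)
      ∎
    where
    shift-alternate : ∀ a → shift (alternate a) ≋ - 1# · alternate (shift a)
    shift-alternate a i = trans (sym (-‿distribˡ-* _ _)) (sym (-1*x≈-x _))
    factor : ∀ m s x y → m * (s * x) + m * (s * y) ≈ (m * s) * (x + y)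
    factor = solve 4 (λ m s x y → m :* (s :* x) :+ m :* (s :* y) := (m :* s) :* (x :+ y)) refl

  fallFact-neg : ∀ x μ → fallFact R x (- μ) ≋ alternate (fallFact R (- x) μ)
  fallFact-neg x μ zero = sym (*-identityˡ _)
  fallFact-neg x μ (suc n) = begin
    fallFact R x (- μ) n * (x - ℕ→R R n * - μ)                         ≈⟨ *-congʳ (fallFact-neg x μ n) ⟩
    negOnePow R n * fallFact R (- x) μ n * (x - ℕ→R R n * - μ)         ≈⟨ shuffle _ _ _ _ _ ⟩
    - negOnePow R n * (fallFact R (- x) μ n * (- x - ℕ→R R n * μ))     ∎
    where
    shuffle : ∀ s f x m u → s * f * (x - m * - u) ≈ - s * (f * (- x - m * u))
    shuffle = solve 5 (λ s f x m u → s :* f :* (x :- m :* :- u) := :- s :* (f :* (:- x :- m :* u))) refl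

  -- Degenerate Euler numbers

  two : Carrier
  two = 1# + 1#

  -- The coefficientwise form of ((1 + μt)^{1/μ} + 1) E(t) = 2, the coefficients of
  -- (1 + μt)^{1/μ} being the falling factorials (1)_{n,μ}.
  EulerEquation : Carrier → Seq → Set ℓ
  EulerEquation μ X = X ⊕ fallFact R 1# μ ⋆ X ≋ two · δ

  EulerEquation-suc : ∀ {μ X} → EulerEquation μ X →
    ∀ n → (X (suc n) + X (suc n)) + binomialTail (fallFact R 1# μ) X n ≈ 0#
  EulerEquation-suc {μ} {X} eq n = begin
    (X (suc n) + X (suc n)) + binomialTail e X n        ≈⟨ +-assoc _ _ _ ⟩
    X (suc n) + (X (suc n) + binomialTail e X n)        ≈⟨ +-congˡ (trans (⋆-suc e X n) (+-congʳ (*-identityˡ _))) ⟨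
    X (suc n) + (e ⋆ X) (suc n)                         ≈⟨ eq (suc n) ⟩
    two * 0#                                            ≈⟨ zeroʳ two ⟩
    0#                                                  ∎
    where
    e : Seq
    e = fallFact R 1# μ

  module _ (half : Carrier) (half+half≈1 : half + half ≈ 1#) where

    +-double-injective : ∀ {x y} → x + x ≈ y + y → x ≈ y
    +-double-injective {x} {y} x+x≈y+y = begin
      x                  ≈⟨ halve x ⟩
      half * (x + x)     ≈⟨ *-congˡ x+x≈y+y ⟩
      half * (y + y)     ≈⟨ halve y ⟨
      y                  ∎
      where
      halve : ∀ z → z ≈ half * (z + z)
      halve z = begin
        z                   ≈⟨ *-identityˡ z ⟨
        1# * z              ≈⟨ *-congʳ half+half≈1 ⟨
        (half + half) * z   ≈⟨ [h+h]z≈h[z+z] half z ⟩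
        half * (z + z)      ∎
        where
        [h+h]z≈h[z+z] : ∀ h z → (h + h) * z ≈ h * (z + z)
        [h+h]z≈h[z+z] = solve 2 (λ h z → (h :+ h) :* z := h :* (z :+ z)) refl

    EulerEquation-unique : ∀ {μ X Y} → EulerEquation μ X → EulerEquation μ Y → X ≋ Y
    EulerEquation-unique {μ} {X} {Y} eqX eqY n = agree n n ℕₚ.≤-refl
      where
      agree : ∀ n i → i ≤ n → X i ≈ Y i
      agree zero zero _ = +-double-injective (begin
        X 0 + X 0          ≈⟨ +-congˡ (*-identityˡ _) ⟨
        X 0 + 1# * X 0     ≈⟨ eqX 0 ⟩
        two * 1#           ≈⟨ eqY 0 ⟨
        Y 0 + 1# * Y 0     ≈⟨ +-congˡ (*-identityˡ _) ⟩
        Y 0 + Y 0          ∎)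
      agree (suc n) i i≤1+n with ℕₚ.m≤n⇒m<n∨m≡n i≤1+n
      ... | inj₁ (s≤s i≤n) = agree n i i≤n
      ... | inj₂ ≡.refl = +-double-injective (+-cancelʳ _ _ _ (begin
        (X (suc n) + X (suc n)) + binomialTail e X n   ≈⟨ EulerEquation-suc eqX n ⟩
        0#                                             ≈⟨ EulerEquation-suc eqY n ⟨
        (Y (suc n) + Y (suc n)) + binomialTail e Y n   ≈⟨ +-congˡ (binomialTail-cong e n (λ i i≤n → agree n i i≤n)) ⟨
        (Y (suc n) + Y (suc n)) + binomialTail e X n   ∎))
        where
        e : Seq
        e = fallFact R 1# μ

    private
      eulerStep : Carrier → ℕ → (ℕ → Carrier) → Carrier
      eulerStep μ n q = - (half * sumTo R (suc n) (λ j → ℕ→R R (suc n C suc j) * fallFact R 1# μ (suc j) * q j))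

      -- `eulerTab` is private to Defs, so its rows are obtained by unification, as
      -- Q n j = eulerTab half μ n (n ∸ j) and Y n = eulerTab half μ n (suc n).
      eulerTable : ∀ μ → Σ[ Q ∈ (ℕ → ℕ → Carrier) ] Σ[ Y ∈ (ℕ → Carrier) ]
          (∀ n → degEuler R half μ (suc n) ≡ (if suc n ≤ᵇ n then Y n else eulerStep μ n (Q n)))
        × (∀ n j → Q (suc n) (suc j) ≡ (if n ∸ j ≤ᵇ n then Q n j else eulerStep μ n (Q n)))
        × (∀ n → Q n 0 ≡ degEuler R half μ n)
      eulerTable μ = _ , _ , (λ _ → ≡.refl) , (λ _ _ → ≡.refl) , (λ _ → ≡.refl)

    degEuler-suc : ∀ μ n →
      degEuler R half μ (suc n) ≈ - (half * binomialTail (fallFact R 1# μ) (degEuler R half μ) n)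
    degEuler-suc μ n with eulerTable μ
    ... | Q , _ , unfold , Q-suc , Q-zero = begin
      degEuler R half μ (suc n)
        ≡⟨ ≡.trans (unfold n) (if-¬T (suc n ≤ᵇ n) (ℕₚ.<⇒≱ (ℕₚ.n<1+n n) ∘ ℕₚ.≤ᵇ⇒≤ (suc n) n)) ⟩
      eulerStep μ n (Q n)
        ≈⟨ -‿cong (*-congˡ (sumTo-cong (suc n) (λ j j<1+n →
             *-congˡ (reflexive (Q≡degEuler n j (ℕₚ.≤-pred j<1+n)))))) ⟩
      - (half * binomialTail (fallFact R 1# μ) (degEuler R half μ) n)
        ∎
      where
      Q≡degEuler : ∀ n j → j ≤ n → Q n j ≡ degEuler R half μ (n ∸ j)
      Q≡degEuler n zero _ = Q-zero n
      Q≡degEuler (suc n) (suc j) (s≤s j≤n) =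
        ≡.trans (Q-suc n j) (≡.trans (if-T (n ∸ j ≤ᵇ n) (ℕₚ.≤⇒≤ᵇ (ℕₚ.m∸n≤m n j))) (Q≡degEuler n j j≤n))

    degEuler-EulerEquation : ∀ μ → EulerEquation μ (degEuler R half μ)
    degEuler-EulerEquation μ zero = trans (+-congˡ (*-identityˡ 1#)) (sym (*-identityʳ two))
    degEuler-EulerEquation μ (suc n) = begin
      E (suc n) + (e ⋆ E) (suc n)              ≈⟨ +-congˡ (trans (⋆-suc e E n) (+-congʳ (*-identityˡ _))) ⟩
      E (suc n) + (E (suc n) + t)              ≈⟨ +-cong (degEuler-suc μ n) (+-congʳ (degEuler-suc μ n)) ⟩
      - (half * t) + (- (half * t) + t)        ≈⟨ collect half t ⟩
      t - (half + half) * t                    ≈⟨ +-congˡ (-‿cong (trans (*-congʳ half+half≈1) (*-identityˡ t))) ⟩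
      t - t                                    ≈⟨ -‿inverseʳ t ⟩
      0#                                       ≈⟨ zeroʳ two ⟨
      two * 0#                                 ∎
      where
      e E : Seq
      e = fallFact R 1# μ
      E = degEuler R half μ
      t : Carrier
      t = binomialTail e E n
      collect : ∀ h t → - (h * t) + (- (h * t) + t) ≈ t - (h + h) * t
      collect = solve 2 (λ h t → :- (h :* t) :+ (:- (h :* t) :+ t) := t :- (h :+ h) :* t) refl

    degEuler-neg : ∀ μ → degEuler R half (- μ) ≋ alternate (fallFact R 1# μ ⋆ degEuler R half μ)
    degEuler-neg μ = EulerEquation-unique (degEuler-EulerEquation (- μ)) alternate-solves
      where
      e ē E : Seq
      e = fallFact R 1# μ
      ē = fallFact R (- 1#) μ
      E = degEuler R half μ
      ē⋆e⋆E≋E : ē ⋆ (e ⋆ E) ≋ E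
      ē⋆e⋆E≋E n = begin
        (ē ⋆ (e ⋆ E)) n    ≈⟨ ⋆-assoc ē e E n ⟨
        ((ē ⋆ e) ⋆ E) n    ≈⟨ ⋆-cong (fallFact-⋆-inverse μ 1#) (λ _ → refl) n ⟩
        (δ ⋆ E) n          ≈⟨ ⋆-identityˡ E n ⟩
        E n                ∎
      alternate-two·δ : alternate (two · δ) ≋ two · δ
      alternate-two·δ zero = *-identityˡ _
      alternate-two·δ (suc n) = trans (*-congˡ (zeroʳ two)) (trans (zeroʳ _) (sym (zeroʳ two)))
      alternate-solves : EulerEquation (- μ) (alternate (e ⋆ E))
      alternate-solves n = begin
        alternate (e ⋆ E) n + (fallFact R 1# (- μ) ⋆ alternate (e ⋆ E)) n
          ≈⟨ +-congˡ (⋆-cong (fallFact-neg 1# μ) (λ _ → refl) n) ⟩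
        alternate (e ⋆ E) n + (alternate ē ⋆ alternate (e ⋆ E)) n
          ≈⟨ +-congˡ (alternate-⋆ ē (e ⋆ E) n) ⟩
        alternate (e ⋆ E) n + alternate (ē ⋆ (e ⋆ E)) n
          ≈⟨ +-congˡ (*-congˡ (ē⋆e⋆E≋E n)) ⟩
        negOnePow R n * (e ⋆ E) n + negOnePow R n * E n
          ≈⟨ distribˡ _ _ _ ⟨
        negOnePow R n * ((e ⋆ E) n + E n)
          ≈⟨ *-congˡ (trans (+-comm _ _) (degEuler-EulerEquation μ n)) ⟩
        alternate (two · δ) n
          ≈⟨ alternate-two·δ n ⟩
        two * δ n
          ∎

    degEuler-neg-suc : ∀ μ d →
      degEuler R half (- μ) (suc d) ≈ - (negOnePow R (suc d) * degEuler R half μ (suc d))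
    degEuler-neg-suc μ d = begin
      degEuler R half (- μ) (suc d)                                          ≈⟨ degEuler-neg μ (suc d) ⟩
      negOnePow R (suc d) * (fallFact R 1# μ ⋆ degEuler R half μ) (suc d)   ≈⟨ *-congˡ e⋆E≈-E ⟩
      negOnePow R (suc d) * - degEuler R half μ (suc d)                     ≈⟨ -‿distribʳ-* _ _ ⟨
      - (negOnePow R (suc d) * degEuler R half μ (suc d))                   ∎
      where
      e⋆E≈-E : (fallFact R 1# μ ⋆ degEuler R half μ) (suc d) ≈ - degEuler R half μ (suc d)
      e⋆E≈-E = +-inverseʳ-unique _ _ (trans (degEuler-EulerEquation μ (suc d)) (zeroʳ two))

    degEuler-neg-term : ∀ μ {k l} → l < k →
      negOnePow R (k ℕ.+ l) * degEuler R half (- μ) (k ∸ l) ≈ - degEuler R half μ (k ∸ l)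
    degEuler-neg-term μ {k} {l} l<k = begin
      negOnePow R (k ℕ.+ l) * degEuler R half (- μ) (k ∸ l)
        ≡⟨ ≡.cong (λ n → negOnePow R (k ℕ.+ l) * degEuler R half (- μ) n) k∸l≡1+d ⟩
      negOnePow R (k ℕ.+ l) * degEuler R half (- μ) (suc d)
        ≈⟨ *-congˡ (degEuler-neg-suc μ d) ⟩
      negOnePow R (k ℕ.+ l) * - (negOnePow R (suc d) * degEuler R half μ (suc d))
        ≡⟨ ≡.cong (λ n → negOnePow R (k ℕ.+ l) * - (negOnePow R n * degEuler R half μ n)) k∸l≡1+d ⟨
      negOnePow R (k ℕ.+ l) * - (negOnePow R (k ∸ l) * degEuler R half μ (k ∸ l))
        ≈⟨ x*-[y*z]≈-[x*y*z] _ _ _ ⟩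
      - (negOnePow R (k ℕ.+ l) * negOnePow R (k ∸ l) * degEuler R half μ (k ∸ l))
        ≈⟨ -‿cong (trans (*-congʳ (negOnePow-+-∸ (ℕₚ.<⇒≤ l<k))) (*-identityˡ _)) ⟩
      - degEuler R half μ (k ∸ l)
        ∎
      where
      d : ℕ
      d = k ∸ suc l
      k∸l≡1+d : k ∸ l ≡ suc d
      k∸l≡1+d = ℕₚ.+-∸-assoc 1 l<k
      x*-[y*z]≈-[x*y*z] : ∀ x y z → x * - (y * z) ≈ - (x * y * z)
      x*-[y*z]≈-[x*y*z] = solve 3 (λ x y z → x :* :- (y :* z) := :- (x :* y :* z)) refl

    degEuler-neg-summand : ∀ μ {k l} → l < k →
      ℕ→R R (k C l) * negOnePow R (k ℕ.+ l) * fallFact R 1# μ l * degEuler R half (- μ) (k ∸ l)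
        ≈ - (ℕ→R R (k C l) * fallFact R 1# μ l * degEuler R half μ (k ∸ l))
    degEuler-neg-summand μ {k} {l} l<k = begin
      b * s * f * degEuler R half (- μ) (k ∸ l)   ≈⟨ shuffle _ _ _ _ ⟩
      b * f * (s * degEuler R half (- μ) (k ∸ l)) ≈⟨ *-congˡ (degEuler-neg-term μ l<k) ⟩
      b * f * - degEuler R half μ (k ∸ l)         ≈⟨ -‿distribʳ-* _ _ ⟨
      - (b * f * degEuler R half μ (k ∸ l))       ∎
      where
      b s f : Carrier
      b = ℕ→R R (k C l)
      s = negOnePow R (k ℕ.+ l)
      f = fallFact R 1# μ l
      shuffle : ∀ b s f x → b * s * f * x ≈ b * f * (s * x)
      shuffle = solve 4 (λ b s f x → b :* s :* f :* x := b :* f :* (s :* x)) refl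

corollary2p11 : ∀ {c ℓ} (R : CommutativeRing c ℓ) →
    let open CommutativeRing R in
    (half : Carrier) → (half + half) ≈ 1# →
    (lam : Carrier) (k : ℕ) → 1 ≤ k →
    degEuler R half lam k
      ≈ (- fallFact R 1# lam k)
        + sumTo R k (λ l → ℕ→R R (k C l) * negOnePow R (k Data.Nat.+ l)
                             * fallFact R 1# lam l * degEuler R half (- lam) (k ∸ l))
corollary2p11 R half half+half≈1 lam k@(suc _) _ = begin
  E k
    ≈⟨ +-inverseˡ-unique _ _ (trans (degEuler-EulerEquation half half+half≈1 lam k) (zeroʳ two)) ⟩
  - (e ⋆ E) k
    ≈⟨ -‿cong (trans (⋆-binomial-last e E k) (+-congˡ (*-identityʳ _))) ⟩
  - (sumTo R k u + e k)
    ≈⟨ trans (-‿+-comm _ _) (-‿cong (+-comm _ _)) ⟨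
  - e k + - sumTo R k u
    ≈⟨ +-congˡ (sumTo-neg k u) ⟨
  - e k + sumTo R k (λ l → - u l)
    ≈⟨ +-congˡ (sumTo-cong k (λ _ l<k → sym (degEuler-neg-summand half half+half≈1 lam l<k))) ⟩
  - e k + sumTo R k (λ l → ℕ→R R (k C l) * negOnePow R (k ℕ.+ l) * e l * degEuler R half (- lam) (k ∸ l))
    ∎
  where
  open CommutativeRing R
  open import Algebra.Properties.Ring ring using (-‿+-comm; +-inverseˡ-unique)
  open import Relation.Binary.Reasoning.Setoid setoid
  open DegenerateEulerNumbers R
  e E : Seq
  e = fallFact R 1# lam
  E = degEuler R half lam
  u : ℕ → Carrier
  u l = ℕ→R R (k C l) * e l * E (k ∸ l)
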